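{- Let $G$ be a $3$-connected graph and let $\{v_1,\dots,v_k\}$ be an independent set of $G$. For every $i\in[k]$ let $(N^i_1,N^i_2)$ be a partition of $N(v_i)$ with both parts nonempty. Then there is a subset $S\subseteq\{v_1,\dots,v_k\}$ with $|S|\ge k/3$ such that the graph obtained from $G$ by splitting every $v_i\in S$ along $(N^i_1,N^i_2)$ is connected.
   Context: Graphs are finite and simple; $N(v)$ is the set of neighbors of $v$. A graph is $3$-connected if it has at least $4$ vertices and $G\setminus S$ is connected for every $S\subseteq V(G)$ with $|S|\le 2$. Splitting $v$ along a partition $(N_1,N_2)$ of $N(v)$ with nonempty parts: delete $v$, add two new vertices $v^1,v^2$, join $v^1$ to every vertex of $N_1$ and $v^2$ to every vertex of $N_2$. -}

module Defs where

open import Data.Nat using (ℕ; _≤_; _*_)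
open import Data.Fin using (Fin)
open import Data.Fin.Subset using (Subset; _∈_; _∉_; ∣_∣)
open import Data.Bool using (Bool; true; false)
open import Data.Product using (Σ; _×_; _,_)
open import Data.Sum using (_⊎_; inj₁; inj₂)
open import Relation.Binary.PropositionalEquality using (_≡_; _≢_)
open import Relation.Nullary using (¬_)

record Graph : Set where
  field
    n      : ℕ
    adj    : Fin n → Fin n → Bool
    sym    : ∀ u w → adj u w ≡ adj w u
    irrefl : ∀ u → adj u u ≡ false

data Reach {V : Set} (P : V → Set) (E : V → V → Set) : V → V → Set where
  here : ∀ {x} → Reach P E x x
  step : ∀ {x y z} → E x y → P y → Reach P E y z → Reach P E x z

Connected : {V : Set} → (V → Set) → (V → V → Set) → Set
Connected {V} P E = ∀ (x y : V) → P x → P y → Reach P E x y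

module _ (G : Graph) where
  open Graph G

  Adj : Fin n → Fin n → Set
  Adj u w = adj u w ≡ true

  ThreeConnected : Set
  ThreeConnected = 4 ≤ n × (∀ (S : Subset n) → ∣ S ∣ ≤ 2 → Connected (λ u → u ∉ S) Adj)

  Independent : {k : ℕ} → (Fin k → Fin n) → Set
  Independent {k} v = (∀ i j → v i ≡ v j → i ≡ j) × (∀ i j → ¬ Adj (v i) (v j))

  -- side i : Fin n → Bool encodes the partition (N^i_1 , N^i_2) of N(v_i):
  -- N^i_1 = {u ∈ N(v_i) | side i u ≡ false},  N^i_2 = {u ∈ N(v_i) | side i u ≡ true}.
  -- Both parts nonempty:
  ProperPartitions : {k : ℕ} → (Fin k → Fin n) → (Fin k → Fin n → Bool) → Set
  ProperPartitions {k} v side =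
    ∀ i → (Σ (Fin n) λ u → Adj (v i) u × side i u ≡ false)
        × (Σ (Fin n) λ u → Adj (v i) u × side i u ≡ true)

  -- Vertices: inj₁ u for an original vertex u not split; inj₂ (i , false) = v_i^1,
  -- inj₂ (i , true) = v_i^2 for i ∈ T.
  SplitV : ℕ → Set
  SplitV k = Fin n ⊎ (Fin k × Bool)

  module _ {k : ℕ} (v : Fin k → Fin n) (side : Fin k → Fin n → Bool) (T : Subset k) where

    SplitPresent : SplitV k → Set
    SplitPresent (inj₁ u)       = ¬ (Σ (Fin k) λ i → i ∈ T × v i ≡ u)
    SplitPresent (inj₂ (i , b)) = i ∈ T

    SplitAdj : SplitV k → SplitV k → Set
    SplitAdj (inj₁ u)       (inj₁ w)       = Adj u w
    SplitAdj (inj₁ u)       (inj₂ (j , c)) = Adj (v j) u × side j u ≡ c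
    SplitAdj (inj₂ (i , b)) (inj₁ w)       = Adj (v i) w × side i w ≡ b
    SplitAdj (inj₂ (i , b)) (inj₂ (j , c)) =
      Adj (v i) (v j) × side i (v j) ≡ b × side j (v i) ≡ c

    SplitConnected : Set
    SplitConnected = Connected SplitPresent SplitAdj

-- Fix a vertex y₀ outside {v₁,…,v_k} and let H_U be the graph in which every vᵢ is split and,
-- for i ∈ U, the two halves of vᵢ are joined by an edge; contracting these edges yields the graph
-- split exactly at the complement of U.  Start with U = ∅.  If some half is not reachable from y₀
-- in H_U, then (G being connected) for some i exactly one half of vᵢ is reachable; put i into U.
-- The component of the other half contains halves of at least three distinct vⱼ, for otherwise
-- those at most two vertices would separate a neighbour of that half from y₀, against
-- 3-connectivity; all of them become reachable.  So the number of reachable halves, which is at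
-- most 2k, grows by at least 3 per step: when the process stops, 3|U| ≤ 2k and |∁ U| ≥ k/3.

module Submission where

open import Data.Bool using (Bool; true; false; not)
import Data.Bool.Properties as Bool
open import Data.Empty using (⊥-elim) renaming (⊥ to Empty)
open import Data.Fin using (Fin; zero; suc; fromℕ<)
open import Data.Fin.Properties using (_≟_; any?; all?)
open import Data.Fin.Subset using (Subset; _∈_; _∉_; _∪_; ⁅_⁆; ∁; ∣_∣; inside; outside) renaming (⊥ to ∅)
open import Data.Fin.Subset.Properties
  using (_∈?_; x∈⁅x⁆; x∈⁅y⁆⇒x≡y; p⊆p∪q; q⊆p∪q; x∈p∪q⁻; ∉⊥; ∣⊥∣≡0; ∣⁅x⁆∣≡1;
         ∣∁p∣≡n∸∣p∣; x∈∁p⇒x∉p; x∉p⇒x∈∁p)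
open import Data.List using (List; []; _∷_; map; _++_; allFin; cartesianProduct)
open import Data.List.Membership.Propositional using () renaming (_∈_ to _∈ₗ_)
open import Data.List.Membership.Propositional.Properties
  using (∈-map⁺; ∈-++⁺ˡ; ∈-++⁺ʳ; ∈-allFin; ∈-cartesianProduct⁺)
open import Data.List.Relation.Unary.Any using (here; there)
open import Data.Nat using (ℕ; zero; suc; _+_; _*_; _∸_; _≤_; _<_; z≤n; s≤s)
open import Data.Nat.Properties
  using (module ≤-Reasoning; +-0-monoid; _≤?_; ≤-refl; ≤-trans; ≤-reflexive; ≤-pred; ≰⇒>; <⇒≱; n≤1+n;
         m≤n+m; +-assoc; +-suc; +-identityʳ; +-comm; +-mono-≤; +-monoˡ-≤; +-monoʳ-≤; +-mono-<-≤;
         +-mono-≤-<; *-comm; *-suc; *-monoʳ-≤; *-distribˡ-∸; ∸-monoʳ-≤; m+n∸n≡m)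
import Data.Product.Properties as Product
open import Data.Product using (Σ; ∃; _×_; _,_; proj₁; proj₂; uncurry)
open import Data.Sum using (_⊎_; inj₁; inj₂; [_,_]′)
import Data.Sum.Properties as Sum
open import Algebra.Properties.Monoid.Sum +-0-monoid using (sum)
open import Data.Unit using (⊤; tt)
open import Data.Vec using (_∷_; [])
open import Data.Vec.Base using (here; there)
open import Function using (id; _∘_)
open import Relation.Binary.Definitions using (DecidableEquality)
open import Relation.Binary.PropositionalEquality using (_≡_; _≢_; refl; sym; trans; cong; subst)
open import Relation.Nullary using (¬_; Dec; yes; no; does; ¬?)
open import Relation.Nullary.Decidable using (map′; _×-dec_; _⊎-dec_)
open import Relation.Unary using (Decidable)

open import Defs

module _ {V : Set} {P : V → Set} {E : V → V → Set} where

  infixr 5 _◅◅_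

  _◅◅_ : ∀ {x y z} → Reach P E x y → Reach P E y z → Reach P E x z
  here         ◅◅ q = q
  step e py p  ◅◅ q = step e py (p ◅◅ q)

  reverse : (∀ {x y} → E x y → E y x) → ∀ {x y} → P x → Reach P E x y → Reach P E y x
  reverse E-sym px here          = here
  reverse E-sym px (step e py p) = reverse E-sym py p ◅◅ step (E-sym e) px here

  propagate : {F : V → Set} → (∀ {x y} → E x y → P y → F x → F y) →
              ∀ {x y} → Reach P E x y → F x → F y
  propagate F-step here          fx = fx
  propagate F-step (step e py p) fx = propagate F-step p (F-step e py fx)

  gmap : {W : Set} {P′ : W → Set} {E′ : W → W → Set} (f : V → W) →
         (∀ {x} → P x → P′ (f x)) → (∀ {x y} → E x y → f x ≡ f y ⊎ E′ (f x) (f y)) →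
         ∀ {x y} → Reach P E x y → Reach P′ E′ (f x) (f y)
  gmap f f-P f-E here = here
  gmap {P′ = P′} {E′} f f-P f-E (step {z = z} e py p) with f-E e
  ... | inj₁ fx≡fy = subst (λ w → Reach P′ E′ w (f z)) (sym fx≡fy) (gmap f f-P f-E p)
  ... | inj₂ e′    = step e′ (f-P py) (gmap f f-P f-E p)

  -- Walks whose interior vertices lie in L, as binary trees of concatenations: this makes
  -- removing the head of L structural, as in the Floyd–Warshall recursion.
  data Via (L : List V) : V → V → Set where
    edge : ∀ {x y} → E x y → Via L x y
    join : ∀ {x y z} → Via L x z → z ∈ₗ L → P z → Via L z y → Via L x y

  Through : V → List V → V → V → Set
  Through w L x y = P w × Via L x w × Via L w y

  Via-there : ∀ {w L x y} → Via L x y → Via (w ∷ L) x y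
  Via-there (edge e)          = edge e
  Via-there (join p z∈L pz q) = join (Via-there p) (there z∈L) pz (Via-there q)

  Via-∷⁺ : ∀ {w L x y} → Via L x y ⊎ Through w L x y → Via (w ∷ L) x y
  Via-∷⁺ (inj₁ p)            = Via-there p
  Via-∷⁺ (inj₂ (pw , p , q)) = join (Via-there p) (here refl) pw (Via-there q)

  Via-∷⁻ : ∀ {w L x y} → Via (w ∷ L) x y → Via L x y ⊎ Through w L x y
  Via-∷⁻ (edge e)                 = inj₁ (edge e)
  Via-∷⁻ (join p (here refl) pw q) =
    inj₂ (pw , [ id , proj₁ ∘ proj₂ ]′ (Via-∷⁻ p) , [ id , proj₂ ∘ proj₂ ]′ (Via-∷⁻ q))
  Via-∷⁻ {w} {L} (join {x} {y} {z} p (there z∈L) pz q) = glue (Via-∷⁻ p) (Via-∷⁻ q)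
    where
    glue : Via L x z ⊎ Through w L x z → Via L z y ⊎ Through w L z y → Via L x y ⊎ Through w L x y
    glue (inj₁ p′)             (inj₁ q′)             = inj₁ (join p′ z∈L pz q′)
    glue (inj₁ p′)             (inj₂ (pw , zw , wy)) = inj₂ (pw , join p′ z∈L pz zw , wy)
    glue (inj₂ (pw , xw , wz)) (inj₁ q′)             = inj₂ (pw , xw , join wz z∈L pz q′)
    glue (inj₂ (pw , xw , _))  (inj₂ (_ , _ , wy))   = inj₂ (pw , xw , wy)

  Via-[]⁻ : ∀ {x y} → Via [] x y → E x y
  Via-[]⁻ (edge e)         = e
  Via-[]⁻ (join _ () _ _)

  Via⇒Reach : ∀ {L x y} → Via L x y → P y → Reach P E x y
  Via⇒Reach (edge e)         py = step e py here
  Via⇒Reach (join p _ pz q) py = Via⇒Reach p pz ◅◅ Via⇒Reach q py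

  Reach⇒Via : ∀ {xs} → (∀ z → z ∈ₗ xs) → ∀ {x y} → Reach P E x y → x ≡ y ⊎ (Via xs x y × P y)
  Reach⇒Via complete here = inj₁ refl
  Reach⇒Via complete (step e py p) with Reach⇒Via complete p
  ... | inj₁ refl     = inj₂ (edge e , py)
  ... | inj₂ (q , pz) = inj₂ (join (edge e) (complete _) py q , pz)

  module _ (P? : Decidable P) (E? : ∀ x y → Dec (E x y)) where

    via? : ∀ L x y → Dec (Via L x y)
    via? []      x y = map′ edge Via-[]⁻ (E? x y)
    via? (w ∷ L) x y = map′ Via-∷⁺ Via-∷⁻ (via? L x y ⊎-dec (P? w ×-dec via? L x w ×-dec via? L w y))

    reach? : DecidableEquality V → (xs : List V) → (∀ z → z ∈ₗ xs) → ∀ x y → Dec (Reach P E x y)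
    reach? _≟_ xs complete x y =
      map′ [ (λ { refl → here }) , uncurry Via⇒Reach ]′ (Reach⇒Via complete)
           (x ≟ y ⊎-dec (via? xs x y ×-dec P? y))

indicator : {A : Set} → Dec A → ℕ
indicator (yes _) = 1
indicator (no _)  = 0

indicator≤1 : {A : Set} (a? : Dec A) → indicator a? ≤ 1
indicator≤1 (yes _) = ≤-refl
indicator≤1 (no _)  = z≤n

indicator-mono : {A B : Set} (a? : Dec A) (b? : Dec B) → (A → B) → indicator a? ≤ indicator b?
indicator-mono (yes a) (yes _) _   = ≤-refl
indicator-mono (yes a) (no ¬b) A→B = ⊥-elim (¬b (A→B a))
indicator-mono (no _)  _       _   = z≤n

indicator-< : {A B : Set} (a? : Dec A) (b? : Dec B) → ¬ A → B → indicator a? < indicator b?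
indicator-< (yes a) _       ¬a _ = ⊥-elim (¬a a)
indicator-< (no _)  (yes _) _  _ = ≤-refl
indicator-< (no _)  (no ¬b) _  b = ⊥-elim (¬b b)

sum-≤-* : ∀ {k c} (g : Fin k → ℕ) → (∀ j → g j ≤ c) → sum g ≤ k * c
sum-≤-* {zero}  g g≤c = z≤n
sum-≤-* {suc k} g g≤c = +-mono-≤ (g≤c zero) (sum-≤-* (g ∘ suc) (g≤c ∘ suc))

sum+∣S∣≤sum : ∀ {k} (g h : Fin k → ℕ) (S : Subset k) → (∀ j → g j ≤ h j) → (∀ {j} → j ∈ S → g j < h j) →
           sum g + ∣ S ∣ ≤ sum h
sum+∣S∣≤sum {zero}  g h []            g≤h g<h = z≤n
sum+∣S∣≤sum {suc k} g h (outside ∷ S) g≤h g<h = begin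
  g zero + sum (g ∘ suc) + ∣ S ∣   ≡⟨ +-assoc (g zero) _ _ ⟩
  g zero + (sum (g ∘ suc) + ∣ S ∣) ≤⟨ +-mono-≤ (g≤h zero) (sum+∣S∣≤sum (g ∘ suc) (h ∘ suc) S (g≤h ∘ suc) (g<h ∘ there)) ⟩
  sum h                            ∎
  where open ≤-Reasoning
sum+∣S∣≤sum {suc k} g h (inside ∷ S) g≤h g<h = begin
  g zero + sum (g ∘ suc) + suc ∣ S ∣   ≡⟨ +-suc _ ∣ S ∣ ⟩
  suc (g zero + sum (g ∘ suc) + ∣ S ∣) ≡⟨ cong suc (+-assoc (g zero) _ _) ⟩
  suc (g zero) + (sum (g ∘ suc) + ∣ S ∣) ≤⟨ +-mono-≤ (g<h here) (sum+∣S∣≤sum (g ∘ suc) (h ∘ suc) S (g≤h ∘ suc) (g<h ∘ there)) ⟩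
  sum h                                ∎
  where open ≤-Reasoning

select : ∀ {k} {P : Fin k → Set} → Decidable P → Subset k
select {zero}  P? = []
select {suc k} P? = does (P? zero) ∷ select (P? ∘ suc)

∈-select⁻ : ∀ {k} {P : Fin k → Set} (P? : Decidable P) {j} → j ∈ select P? → P j
∈-select⁻ P? {zero} j∈ with P? zero
∈-select⁻ P? {zero} j∈ | yes p = p
∈-select⁻ P? {zero} () | no _
∈-select⁻ P? {suc j} (there j∈) = ∈-select⁻ (P? ∘ suc) j∈

∈-select⁺ : ∀ {k} {P : Fin k → Set} (P? : Decidable P) {j} → P j → j ∈ select P?
∈-select⁺ P? {zero} p with P? zero
... | yes _ = here
... | no ¬p = ⊥-elim (¬p p)
∈-select⁺ P? {suc j} p = there (∈-select⁺ (P? ∘ suc) p)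

∣p∪q∣≤∣p∣+∣q∣ : ∀ {n} (p q : Subset n) → ∣ p ∪ q ∣ ≤ ∣ p ∣ + ∣ q ∣
∣p∪q∣≤∣p∣+∣q∣ []            []            = z≤n
∣p∪q∣≤∣p∣+∣q∣ (inside ∷ p)  (inside ∷ q)  = s≤s (≤-trans (∣p∪q∣≤∣p∣+∣q∣ p q) (+-monoʳ-≤ ∣ p ∣ (n≤1+n _)))
∣p∪q∣≤∣p∣+∣q∣ (inside ∷ p)  (outside ∷ q) = s≤s (∣p∪q∣≤∣p∣+∣q∣ p q)
∣p∪q∣≤∣p∣+∣q∣ (outside ∷ p) (inside ∷ q)  =
  ≤-trans (s≤s (∣p∪q∣≤∣p∣+∣q∣ p q)) (≤-reflexive (sym (+-suc ∣ p ∣ ∣ q ∣)))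
∣p∪q∣≤∣p∣+∣q∣ (outside ∷ p) (outside ∷ q) = ∣p∪q∣≤∣p∣+∣q∣ p q

image : ∀ {k m} → (Fin k → Fin m) → Subset k → Subset m
image f []            = ∅
image f (outside ∷ p) = image (f ∘ suc) p
image f (inside ∷ p)  = ⁅ f zero ⁆ ∪ image (f ∘ suc) p

∈-image⁺ : ∀ {k m} (f : Fin k → Fin m) {p j} → j ∈ p → f j ∈ image f p
∈-image⁺ f {inside ∷ p}  here       = p⊆p∪q (image (f ∘ suc) p) (x∈⁅x⁆ (f zero))
∈-image⁺ f {outside ∷ p} (there j∈) = ∈-image⁺ (f ∘ suc) j∈
∈-image⁺ f {inside ∷ p}  (there j∈) = q⊆p∪q ⁅ f zero ⁆ _ (∈-image⁺ (f ∘ suc) j∈)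

∈-image⁻ : ∀ {k m} (f : Fin k → Fin m) p {u} → u ∈ image f p → ∃ λ j → f j ≡ u
∈-image⁻ f []            u∈ = ⊥-elim (∉⊥ u∈)
∈-image⁻ f (outside ∷ p) u∈ with ∈-image⁻ (f ∘ suc) p u∈
... | j , fj≡u = suc j , fj≡u
∈-image⁻ f (inside ∷ p)  u∈ with x∈p∪q⁻ ⁅ f zero ⁆ _ u∈
... | inj₁ u∈⁅f0⁆ = zero , sym (x∈⁅y⁆⇒x≡y (f zero) u∈⁅f0⁆)
... | inj₂ u∈rest with ∈-image⁻ (f ∘ suc) p u∈rest
...   | j , fj≡u = suc j , fj≡u

∣image∣≤∣p∣ : ∀ {k m} (f : Fin k → Fin m) p → ∣ image f p ∣ ≤ ∣ p ∣
∣image∣≤∣p∣ {m = m} f []   = ≤-reflexive (∣⊥∣≡0 m)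
∣image∣≤∣p∣ f (outside ∷ p)     = ∣image∣≤∣p∣ (f ∘ suc) p
∣image∣≤∣p∣ f (inside ∷ p)      = begin
  ∣ ⁅ f zero ⁆ ∪ image (f ∘ suc) p ∣       ≤⟨ ∣p∪q∣≤∣p∣+∣q∣ ⁅ f zero ⁆ _ ⟩
  ∣ ⁅ f zero ⁆ ∣ + ∣ image (f ∘ suc) p ∣  ≡⟨ cong (_+ ∣ image (f ∘ suc) p ∣) (∣⁅x⁆∣≡1 (f zero)) ⟩
  suc ∣ image (f ∘ suc) p ∣              ≤⟨ s≤s (∣image∣≤∣p∣ (f ∘ suc) p) ⟩
  suc ∣ p ∣                              ∎
  where open ≤-Reasoning

3*m≤2*n⇒n≤3*[n∸m] : ∀ m n → 3 * m ≤ 2 * n → n ≤ 3 * (n ∸ m)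
3*m≤2*n⇒n≤3*[n∸m] m n 3m≤2n = begin
  n               ≡⟨ m+n∸n≡m n (2 * n) ⟨
  3 * n ∸ 2 * n   ≤⟨ ∸-monoʳ-≤ (3 * n) 3m≤2n ⟩
  3 * n ∸ 3 * m   ≡⟨ *-distribˡ-∸ 3 n m ⟨
  3 * (n ∸ m)     ∎
  where open ≤-Reasoning

module _ (G : Graph) where
  open Graph G using (n; adj)

  Adj-sym : ∀ {u w} → Adj G u w → Adj G w u
  Adj-sym {u} {w} u~w = trans (Graph.sym G w u) u~w

  adj? : ∀ u w → Dec (Adj G u w)
  adj? u w = adj u w Bool.≟ true

  module _ {k : ℕ} (v : Fin k → Fin n) where

    Outside : Fin n → Set
    Outside u = ∀ i → v i ≢ u

    outside? : Decidable Outside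
    outside? u = all? (λ i → ¬? (v i ≟ u))

    classify : ∀ u → (∃ λ i → v i ≡ u) ⊎ Outside u
    classify u with any? (λ i → v i ≟ u)
    ... | yes found = inj₁ found
    ... | no ¬found = inj₂ (λ i vi≡u → ¬found (i , vi≡u))

    neighbour-outside : Independent G v → ∀ {i u} → Adj G (v i) u → Outside u
    neighbour-outside (_ , nonadjacent) {i} vi~u j vj≡u =
      nonadjacent i j (subst (Adj G (v i)) (sym vj≡u) vi~u)

  outside-vertex : ThreeConnected G → ∀ {k} (v : Fin k → Fin n) → Independent G v →
                   (side : Fin k → Fin n → Bool) → ProperPartitions G v side → ∃ (Outside v)
  outside-vertex (4≤n , _) {zero}  v _     _ _      = fromℕ< (≤-trans (s≤s z≤n) 4≤n) , λ ()
  outside-vertex _         {suc k} v indep _ proper with proj₁ (proper zero)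
  ... | y , v₀~y , _ = y , neighbour-outside v indep v₀~y

module Splitting (G : Graph) (3-connected : ThreeConnected G)
                 {k : ℕ} (v : Fin k → Fin (Graph.n G)) (indep : Independent G v)
                 (side : Fin k → Fin (Graph.n G) → Bool) (proper : ProperPartitions G v side)
                 (y₀ : Fin (Graph.n G)) (y₀-outside : Outside G v y₀) where
  open Graph G using (n)

  V : Set
  V = SplitV G k

  piece : Fin k → Bool → V
  piece i b = inj₂ (i , b)

  neighbour : ∀ i c → ∃ λ u → Adj G (v i) u × side i u ≡ c
  neighbour i false = proj₁ (proper i)
  neighbour i true  = proj₂ (proper i)

  Present : V → Set
  Present (inj₁ u) = Outside G v u
  Present (inj₂ _) = ⊤

  Twin : Subset k → V → V → Set
  Twin U (inj₂ (i , _)) (inj₂ (j , _)) = i ≡ j × i ∈ U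
  Twin U _              _              = Empty

  -- Every vᵢ is split, and for i ∈ U its two halves are joined by an edge; contracting these
  -- edges gives the graph split at ∁ U.  (SplitAdj does not depend on its subset argument.)
  Edge : Subset k → V → V → Set
  Edge U x y = SplitAdj G v side ∅ x y ⊎ Twin U x y

  Edge-sym : ∀ {U x y} → Edge U x y → Edge U y x
  Edge-sym {x = inj₁ _}       {inj₁ _}       (inj₁ u~w) = inj₁ (Adj-sym G u~w)
  Edge-sym {x = inj₁ _}       {inj₂ _}       (inj₁ e)   = inj₁ e
  Edge-sym {x = inj₂ _}       {inj₁ _}       (inj₁ e)   = inj₁ e
  Edge-sym {x = inj₂ (i , _)} {inj₂ (j , _)} (inj₁ (vi~vj , _)) = ⊥-elim (proj₂ indep i j vi~vj)
  Edge-sym {x = inj₂ _}       {inj₂ _}       (inj₂ (refl , i∈U)) = inj₂ (refl , i∈U)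

  Connects : Subset k → V → V → Set
  Connects U = Reach Present (Edge U)

  root : V
  root = inj₁ y₀

  Reachable : Subset k → V → Set
  Reachable U = Connects U root

  Closed : Subset k → Set
  Closed U = ∀ x → Present x → Reachable U x

  Lopsided : Subset k → Fin k → Set
  Lopsided U i = Σ Bool λ b → Reachable U (piece i b) × ¬ Reachable U (piece i (not b))

  present? : Decidable Present
  present? (inj₁ u) = outside? G v u
  present? (inj₂ _) = yes tt

  edge? : ∀ U x y → Dec (Edge U x y)
  edge? U x y = splitAdj? x y ⊎-dec twin? x y
    where
    splitAdj? : ∀ x y → Dec (SplitAdj G v side ∅ x y)
    splitAdj? (inj₁ u)       (inj₁ w)       = adj? G u w
    splitAdj? (inj₁ u)       (inj₂ (j , c)) = adj? G (v j) u ×-dec side j u Bool.≟ c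
    splitAdj? (inj₂ (i , b)) (inj₁ w)       = adj? G (v i) w ×-dec side i w Bool.≟ b
    splitAdj? (inj₂ (i , b)) (inj₂ (j , c)) =
      adj? G (v i) (v j) ×-dec side i (v j) Bool.≟ b ×-dec side j (v i) Bool.≟ c
    twin? : ∀ x y → Dec (Twin U x y)
    twin? (inj₁ _)       _              = no λ ()
    twin? (inj₂ _)       (inj₁ _)       = no λ ()
    twin? (inj₂ (i , _)) (inj₂ (j , _)) = i ≟ j ×-dec i ∈? U

  vertices : List V
  vertices = map inj₁ (allFin n) ++ map inj₂ (cartesianProduct (allFin k) (false ∷ true ∷ []))

  ∈-vertices : ∀ x → x ∈ₗ vertices
  ∈-vertices (inj₁ u)       = ∈-++⁺ˡ (∈-map⁺ inj₁ (∈-allFin u))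
  ∈-vertices (inj₂ (i , b)) =
    ∈-++⁺ʳ (map inj₁ (allFin n)) (∈-map⁺ inj₂ (∈-cartesianProduct⁺ (∈-allFin i) (∈-bools b)))
    where
    ∈-bools : ∀ b → b ∈ₗ false ∷ true ∷ []
    ∈-bools false = here refl
    ∈-bools true  = there (here refl)

  connects? : ∀ U x y → Dec (Connects U x y)
  connects? U = reach? present? (edge? U) (Sum.≡-dec _≟_ (Product.≡-dec _≟_ Bool._≟_)) vertices ∈-vertices

  reachable? : ∀ U x → Dec (Reachable U x)
  reachable? U = connects? U root

  lopsided? : ∀ U i → Dec (Lopsided U i)
  lopsided? U i with reachable? U (piece i false) | reachable? U (piece i true)
  ... | yes r₀ | no ¬r₁  = yes (false , r₀ , ¬r₁)
  ... | no ¬r₀ | yes r₁  = yes (true , r₁ , ¬r₀)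
  ... | yes r₀ | yes r₁  = no λ { (false , _ , ¬r₁) → ¬r₁ r₁ ; (true , _ , ¬r₀) → ¬r₀ r₀ }
  ... | no ¬r₀ | no ¬r₁  = no λ { (false , r₀ , _) → ¬r₀ r₀ ; (true , r₁ , _) → ¬r₁ r₁ }

  G-connected : ∀ u w → Reach (_∉ ∅) (Adj G) u w
  G-connected u w = proj₂ 3-connected ∅ (subst (_≤ 2) (sym (∣⊥∣≡0 n)) z≤n) u w ∉⊥ ∉⊥

  module _ (U : Subset k) (balanced : ∀ i b → Reachable U (piece i b) → Reachable U (piece i (not b))) where

    both-pieces : ∀ {i} b → Reachable U (piece i b) → ∀ c → Reachable U (piece i c)
    both-pieces {i} false r false = r
    both-pieces {i} false r true  = balanced i false r
    both-pieces {i} true  r false = balanced i true r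
    both-pieces {i} true  r true  = r

    Handled : Fin n → Set
    Handled u = (∀ i → v i ≡ u → ∀ b → Reachable U (piece i b)) × (Outside G v u → Reachable U (inj₁ u))

    handled-step : ∀ {u w} → Adj G u w → Handled u → Handled w
    handled-step {u} {w} u~w (pieces-u , vertex-u) with classify G v u
    ... | inj₁ (i , refl) =
      (λ j vj≡w → ⊥-elim (neighbour-outside G v indep u~w j vj≡w)) ,
      (λ w-out → pieces-u i refl (side i w) ◅◅ step (inj₁ (u~w , refl)) w-out here)
    ... | inj₂ u-out =
      (λ j vj≡w → both-pieces (side j u)
         (vertex-u u-out ◅◅ step (inj₁ (subst (λ t → Adj G t u) (sym vj≡w) (Adj-sym G u~w) , refl)) tt here)) ,
      (λ w-out → vertex-u u-out ◅◅ step (inj₁ u~w) w-out here)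

    handled : ∀ u → Handled u
    handled u = propagate (λ u~w _ → handled-step u~w) (G-connected y₀ u)
                  ((λ i vi≡y₀ → ⊥-elim (y₀-outside i vi≡y₀)) , λ _ → here)

    balanced⇒closed : Closed U
    balanced⇒closed (inj₁ u)       u-out = proj₂ (handled u) u-out
    balanced⇒closed (inj₂ (i , b)) _     = proj₁ (handled (v i)) i refl b

  closed-or-lopsided : ∀ U → Closed U ⊎ ∃ (Lopsided U)
  closed-or-lopsided U with any? (lopsided? U)
  ... | yes lopsided = inj₂ lopsided
  ... | no ¬lopsided = inj₁ (balanced⇒closed U balanced)
    where
    balanced : ∀ i b → Reachable U (piece i b) → Reachable U (piece i (not b))
    balanced i b r with reachable? U (piece i (not b))
    ... | yes r′ = r′
    ... | no ¬r′ = ⊥-elim (¬lopsided (i , b , r , ¬r′))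

  reached : Subset k → Fin k → ℕ
  reached U j = indicator (reachable? U (piece j false)) + indicator (reachable? U (piece j true))

  count : Subset k → ℕ
  count U = sum (reached U)

  count≤2k : ∀ U → count U ≤ 2 * k
  count≤2k U = ≤-trans (sum-≤-* (reached U) λ j →
                         +-mono-≤ (indicator≤1 (reachable? U (piece j false)))
                                  (indicator≤1 (reachable? U (piece j true))))
                       (≤-reflexive (*-comm k 2))

  module Growth (U : Subset k) (i : Fin k) (b : Bool)
                (reach-b : Reachable U (piece i b)) (¬reach-q : ¬ Reachable U (piece i (not b))) where

    q : V
    q = piece i (not b)

    U⁺ : Subset k
    U⁺ = ⁅ i ⁆ ∪ U

    Edge-mono : ∀ {x y} → Edge U x y → Edge U⁺ x y
    Edge-mono                       (inj₁ e)            = inj₁ e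
    Edge-mono {inj₂ _} {inj₂ _} (inj₂ (i≡j , j∈U)) = inj₂ (i≡j , q⊆p∪q ⁅ i ⁆ U j∈U)

    Connects-mono : ∀ {x y} → Connects U x y → Connects U⁺ x y
    Connects-mono = gmap id id (inj₂ ∘ Edge-mono)

    from-q⇒reachable⁺ : ∀ {x} → Connects U q x → Reachable U⁺ x
    from-q⇒reachable⁺ q⇝x =
      Connects-mono reach-b ◅◅ step (inj₂ (refl , p⊆p∪q U (x∈⁅x⁆ i))) tt (Connects-mono q⇝x)

    from-q⇒unreachable : ∀ {x} → Connects U q x → ¬ Reachable U x
    from-q⇒unreachable q⇝x r = ¬reach-q (r ◅◅ reverse Edge-sym tt q⇝x)

    hits : Subset k
    hits = select λ j → connects? U q (piece j false) ⊎-dec connects? U q (piece j true)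

    hit : ∀ j c → Connects U q (piece j c) → j ∈ hits
    hit j false q⇝j = ∈-select⁺ _ (inj₁ q⇝j)
    hit j true  q⇝j = ∈-select⁺ _ (inj₂ q⇝j)

    -- The halves hit by the component of q lie on at most two vertices vⱼ, which would separate
    -- q's neighbour on its own side from y₀: walking there in G avoiding them stays in that component.
    few-hits-impossible : ∣ hits ∣ ≤ 2 → Empty
    few-hits-impossible few = ¬reach-q (reverse Edge-sym tt (proj₂ (propagate walk-step y⇝y₀ (y-out , q⇝y))))
      where
      S : Subset n
      S = image v hits

      outside-∉S : ∀ {u} → Outside G v u → u ∉ S
      outside-∉S u-out u∈S = u-out (proj₁ (∈-image⁻ v hits u∈S)) (proj₂ (∈-image⁻ v hits u∈S))

      y : Fin n
      y = proj₁ (neighbour i (not b))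

      vi~y : Adj G (v i) y
      vi~y = proj₁ (proj₂ (neighbour i (not b)))

      y-out : Outside G v y
      y-out = neighbour-outside G v indep vi~y

      q⇝y : Connects U q (inj₁ y)
      q⇝y = step (inj₁ (vi~y , proj₂ (proj₂ (neighbour i (not b))))) y-out here

      y⇝y₀ : Reach (_∉ S) (Adj G) y y₀
      y⇝y₀ = proj₂ 3-connected S (≤-trans (∣image∣≤∣p∣ v hits) few) y y₀
               (outside-∉S y-out) (outside-∉S y₀-outside)

      walk-step : ∀ {u w} → Adj G u w → w ∉ S →
                  Outside G v u × Connects U q (inj₁ u) → Outside G v w × Connects U q (inj₁ w)
      walk-step {u} {w} u~w w∉S (u-out , q⇝u) with classify G v w
      ... | inj₁ (j , refl) =
        ⊥-elim (w∉S (∈-image⁺ v (hit j (side j u) (q⇝u ◅◅ step (inj₁ (Adj-sym G u~w , refl)) tt here))))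
      ... | inj₂ w-out = w-out , q⇝u ◅◅ step (inj₁ u~w) w-out here

    three-hits : 3 ≤ ∣ hits ∣
    three-hits with 3 ≤? ∣ hits ∣
    ... | yes enough = enough
    ... | no ¬enough = ⊥-elim (few-hits-impossible (≤-pred (≰⇒> ¬enough)))

    piece-mono : ∀ j c → indicator (reachable? U (piece j c)) ≤ indicator (reachable? U⁺ (piece j c))
    piece-mono j c = indicator-mono (reachable? U (piece j c)) (reachable? U⁺ (piece j c)) Connects-mono

    piece-< : ∀ {j} c → Connects U q (piece j c) →
              indicator (reachable? U (piece j c)) < indicator (reachable? U⁺ (piece j c))
    piece-< {j} c q⇝j = indicator-< (reachable? U (piece j c)) (reachable? U⁺ (piece j c))
                          (from-q⇒unreachable q⇝j) (from-q⇒reachable⁺ q⇝j)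

    reached-mono : ∀ j → reached U j ≤ reached U⁺ j
    reached-mono j = +-mono-≤ (piece-mono j false) (piece-mono j true)

    reached-< : ∀ {j} → j ∈ hits → reached U j < reached U⁺ j
    reached-< {j} j∈hits with ∈-select⁻ _ j∈hits
    ... | inj₁ q⇝j = +-mono-<-≤ (piece-< false q⇝j) (piece-mono j true)
    ... | inj₂ q⇝j = +-mono-≤-< (piece-mono j false) (piece-< true q⇝j)

    count-grows : 3 + count U ≤ count U⁺
    count-grows = begin
      3 + count U          ≡⟨ +-comm 3 (count U) ⟩
      count U + 3          ≤⟨ +-monoʳ-≤ (count U) three-hits ⟩
      count U + ∣ hits ∣   ≤⟨ sum+∣S∣≤sum (reached U) (reached U⁺) hits reached-mono reached-< ⟩
      count U⁺             ∎
      where open ≤-Reasoning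

  iterate : ∀ fuel U → 3 * ∣ U ∣ ≤ count U → 2 * k < count U + fuel →
            ∃ λ U → 3 * ∣ U ∣ ≤ count U × Closed U
  iterate fuel U inv enough with closed-or-lopsided U
  ... | inj₁ closed = U , inv , closed
  iterate zero U inv enough | inj₂ _ =
    ⊥-elim (<⇒≱ (subst (2 * k <_) (+-identityʳ (count U)) enough) (count≤2k U))
  iterate (suc fuel) U inv enough | inj₂ (i , b , reach-b , ¬reach-q) =
    iterate fuel U⁺ inv⁺ enough⁺
    where
    open Growth U i b reach-b ¬reach-q using (U⁺; count-grows)
    open ≤-Reasoning

    inv⁺ : 3 * ∣ U⁺ ∣ ≤ count U⁺
    inv⁺ = begin
      3 * ∣ U⁺ ∣               ≤⟨ *-monoʳ-≤ 3 (∣p∪q∣≤∣p∣+∣q∣ ⁅ i ⁆ U) ⟩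
      3 * (∣ ⁅ i ⁆ ∣ + ∣ U ∣)  ≡⟨ cong (λ m → 3 * (m + ∣ U ∣)) (∣⁅x⁆∣≡1 i) ⟩
      3 * suc ∣ U ∣            ≡⟨ *-suc 3 ∣ U ∣ ⟩
      3 + 3 * ∣ U ∣            ≤⟨ +-monoʳ-≤ 3 inv ⟩
      3 + count U              ≤⟨ count-grows ⟩
      count U⁺                 ∎

    enough⁺ : 2 * k < count U⁺ + fuel
    enough⁺ = begin-strict
      2 * k                <⟨ enough ⟩
      count U + suc fuel   ≡⟨ +-suc (count U) fuel ⟩
      suc (count U) + fuel ≤⟨ +-monoˡ-≤ fuel (m≤n+m (suc (count U)) 2) ⟩
      3 + count U + fuel   ≤⟨ +-monoˡ-≤ fuel count-grows ⟩
      count U⁺ + fuel      ∎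

  module _ (U : Subset k) where

    contract : V → V
    contract (inj₁ u) = inj₁ u
    contract (inj₂ (i , b)) with i ∈? U
    ... | yes _ = inj₁ (v i)
    ... | no _  = piece i b

    contract-present : ∀ {x} → Present x → SplitPresent G v side (∁ U) (contract x)
    contract-present {inj₁ u} u-out (i , _ , vi≡u) = u-out i vi≡u
    contract-present {inj₂ (i , b)} _ with i ∈? U
    ... | yes i∈U = λ { (j , j∈∁U , vj≡vi) →
                          x∈∁p⇒x∉p (subst (_∈ ∁ U) (proj₁ indep j i vj≡vi) j∈∁U) i∈U }
    ... | no i∉U  = x∉p⇒x∈∁p i∉U

    contract-edge : ∀ {x y} → Edge U x y →
                    contract x ≡ contract y ⊎ SplitAdj G v side (∁ U) (contract x) (contract y)
    contract-edge {inj₁ _} {inj₁ _} (inj₁ u~w) = inj₂ u~w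
    contract-edge {inj₁ _} {inj₂ (j , _)} (inj₁ e) with j ∈? U
    ... | yes _ = inj₂ (Adj-sym G (proj₁ e))
    ... | no _  = inj₂ e
    contract-edge {inj₂ (i , _)} {inj₁ _} (inj₁ e) with i ∈? U
    ... | yes _ = inj₂ (proj₁ e)
    ... | no _  = inj₂ e
    contract-edge {inj₂ (i , _)} {inj₂ (j , _)} (inj₁ (vi~vj , _)) = ⊥-elim (proj₂ indep i j vi~vj)
    contract-edge {inj₂ (i , _)} {inj₂ _} (inj₂ (refl , i∈U)) with i ∈? U
    ... | yes _   = inj₁ refl
    ... | no i∉U  = ⊥-elim (i∉U i∈U)

    contract-piece : ∀ i b → (i ∈ U × contract (piece i b) ≡ inj₁ (v i))
                           ⊎ (i ∉ U × contract (piece i b) ≡ piece i b)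
    contract-piece i b with i ∈? U
    ... | yes i∈U = inj₁ (i∈U , refl)
    ... | no i∉U  = inj₂ (i∉U , refl)

    contract-onto : ∀ x → SplitPresent G v side (∁ U) x → ∃ λ z → Present z × contract z ≡ x
    contract-onto (inj₁ u) u-present with classify G v u
    ... | inj₂ u-out = inj₁ u , u-out , refl
    ... | inj₁ (i , refl) with contract-piece i false
    ...   | inj₁ (_ , merged) = piece i false , tt , merged
    ...   | inj₂ (i∉U , _)    = ⊥-elim (u-present (i , x∉p⇒x∈∁p i∉U , refl))
    contract-onto (inj₂ (i , b)) i∈∁U with contract-piece i b
    ... | inj₁ (i∈U , _) = ⊥-elim (x∈∁p⇒x∉p i∈∁U i∈U)
    ... | inj₂ (_ , kept) = piece i b , tt , kept

    closed⇒split-connected : Closed U → SplitConnected G v side (∁ U)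
    closed⇒split-connected closed x y x-present y-present
      with contract-onto x x-present | contract-onto y y-present
    ... | x′ , x′-present , refl | y′ , y′-present , refl =
      gmap contract contract-present contract-edge
        (reverse Edge-sym y₀-outside (closed x′ x′-present) ◅◅ closed y′ y′-present)

  third-split-connected : Σ (Subset k) λ T → (k ≤ 3 * ∣ T ∣) × SplitConnected G v side T
  third-split-connected with iterate (suc (2 * k)) ∅ inv₀ (m≤n+m (suc (2 * k)) (count ∅))
    where
    inv₀ : 3 * ∣ ∅ {k} ∣ ≤ count ∅
    inv₀ = subst (λ m → 3 * m ≤ count ∅) (sym (∣⊥∣≡0 k)) z≤n
  ... | U , inv , closed = ∁ U , large , closed⇒split-connected U closed
    where
    large : k ≤ 3 * ∣ ∁ U ∣
    large = subst (λ m → k ≤ 3 * m) (sym (∣∁p∣≡n∸∣p∣ U))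
              (3*m≤2*n⇒n≤3*[n∸m] ∣ U ∣ k (≤-trans inv (count≤2k U)))

lemma9 : (G : Graph) → ThreeConnected G →
         (k : ℕ) (v : Fin k → Fin (Graph.n G)) → Independent G v →
         (side : Fin k → Fin (Graph.n G) → Bool) → ProperPartitions G v side →
         Σ (Subset k) λ T → (k ≤ 3 * ∣ T ∣) × SplitConnected G v side T
lemma9 G 3-connected k v indep side proper with outside-vertex G 3-connected v indep side proper
... | y₀ , y₀-outside = Splitting.third-split-connected G 3-connected v indep side proper y₀ y₀-outside
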